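{- Consider a tiling $\mathcal{T}$ with row $r$ and set of cells $S$ in row $r$ to which row separation applies, and let $\Gamma=\Gamma_{r,S}$ be the row-separation map. Let $h,g \in \operatorname{Grid}(\mathcal{T})$ and suppose $\Gamma(h) \leq \Gamma(g)$. Then $h \leq g$.
   Context: A gridded permutation of size $n$ is a pair $(\pi,(c_1,\ldots,c_n))$ with $\pi$ a permutation of length $n$ and cells $c_i\in\mathbb{N}\times\mathbb{N}$, the entry $(i,\pi(i))$ being drawn in the square $[x,x+1)\times[y,y+1)$ where $c_i=(x,y)$, consistently with $\pi$. A gridded permutation $g=(\pi,(c_1,\ldots,c_n))$ contains $h=(\sigma,(d_1,\ldots,d_k))$, written $h\le g$, if there are indices $i_1<\cdots<i_k$ such that $\pi(i_1)\cdots\pi(i_k)$ is order-isomorphic to $\sigma$ and $c_{i_j}=d_j$ for all $j$. A tiling $\mathcal{T}=((t,u),\mathcal{O},\{\mathcal{R}_1,\ldots,\mathcal{R}_k\})$ represents the set $\operatorname{Grid}(\mathcal{T})$ of gridded permutations with all cells in $[0,t)\times[0,u)$ that avoid every obstruction in $\mathcal{O}$ and contain at least one element of each requirement list $\mathcal{R}_i$. Row separation applies to row $r$ and a nonempty subset $S$ of the nonempty cells of row $r$ if, letting $S'$ be the remaining nonempty cells of row $r$, for every pair $(c_1,c_2)\in S\times S'$: if $c_1$ is left of $c_2$ then $(21,(c_1,c_2))\in\mathcal{O}$, and if $c_1$ is right of $c_2$ then $(12,(c_2,c_1))\in\mathcal{O}$. The cell map is $\gamma=\gamma_{r,S}:(i,j)\mapsto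 (i,j)$ if $j<r$ or ($j=r$ and $i\in S$), and $(i,j)\mapsto(i,j+1)$ if $j>r$ or ($j=r$ and $i\notin S$); with codomain equal to its range, $\gamma$ is a bijection. The map $\Gamma=\Gamma_{r,S}$ is defined by $\Gamma((\pi,(c_1,\ldots,c_n)))=(\pi,(\gamma(c_1),\ldots,\gamma(c_n)))$, which is a valid gridded permutation for elements of $\operatorname{Grid}(\mathcal{T})$. -}

module Defs where

open import Data.Nat using (ℕ; zero; suc; _<_; _≤_; _<?_; _≟_)
open import Data.Fin as Fin using (Fin)
open import Data.Vec using (Vec; []; _∷_; lookup; map)
open import Data.List using (List; [])
open import Data.List.Membership.Propositional using (_∈_; _∉_)
open import Data.List.Membership.DecPropositional _≟_ using (_∈?_)
open import Data.Product using (Σ; ∃; ∃-syntax; _×_; _,_; proj₁; proj₂)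
open import Relation.Binary.PropositionalEquality using (_≡_; _≢_)
open import Relation.Nullary using (¬_; yes; no)
open import Function.Bundles using (_⇔_)

-- A cell (x , y) ∈ ℕ × ℕ : x = column, y = row.
Cell : Set
Cell = ℕ × ℕ

-- Raw gridded permutation: size n, one-line notation π (values 0..n-1,
-- π(i) = lookup perm i) and the cells c_1..c_n.
record GP : Set where
  constructor gp
  field
    size  : ℕ
    perm  : Vec ℕ size
    cells : Vec Cell size
open GP public

IsPerm : ∀ {n} → Vec ℕ n → Set
IsPerm {n} π = (∀ i → lookup π i < n) × (∀ i j → lookup π i ≡ lookup π j → i ≡ j)

Consistent : ∀ {n} → Vec ℕ n → Vec Cell n → Set
Consistent π c =
  (∀ i j → i Fin.< j → proj₁ (lookup c i) ≤ proj₁ (lookup c j)) ×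
  (∀ i j → lookup π i < lookup π j → proj₂ (lookup c i) ≤ proj₂ (lookup c j))

IsGP : GP → Set
IsGP g = IsPerm (perm g) × Consistent (perm g) (cells g)

_≼_ : GP → GP → Set
h ≼ g = Σ (Fin (size h) → Fin (size g)) λ e →
  (∀ a b → a Fin.< b → e a Fin.< e b) ×
  (∀ a b → (lookup (perm h) a < lookup (perm h) b) ⇔
           (lookup (perm g) (e a) < lookup (perm g) (e b))) ×
  (∀ a → lookup (cells h) a ≡ lookup (cells g) (e a))

record Tiling : Set where
  constructor tiling
  field
    t    : ℕ
    u    : ℕ
    obs  : List GP
    reqs : List (List GP)
open Tiling public

InGrid : Tiling → GP → Set
InGrid T g =
  IsGP g ×
  (∀ i → proj₁ (lookup (cells g) i) < t T × proj₂ (lookup (cells g) i) < u T) ×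
  (∀ o → o ∈ obs T → ¬ (o ≼ g)) ×
  (∀ R → R ∈ reqs T → ∃[ h ] (h ∈ R × h ≼ g))

point : Cell → GP
point c = gp 1 (0 ∷ []) (c ∷ [])

ob21 : Cell → Cell → GP
ob21 c₁ c₂ = gp 2 (1 ∷ 0 ∷ []) (c₁ ∷ c₂ ∷ [])

ob12 : Cell → Cell → GP
ob12 c₁ c₂ = gp 2 (0 ∷ 1 ∷ []) (c₁ ∷ c₂ ∷ [])

Nonempty : Tiling → Cell → Set
Nonempty T (x , y) = x < t T × y < u T × point (x , y) ∉ obs T

-- Row separation applies to row r and S (a set of columns, i.e. the cells
-- (i , r) for i ∈ S): S nonempty, S ⊆ nonempty cells of row r, and for
-- every (i,r) ∈ S and every nonempty (j,r) with j ∉ S the required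
-- obstructions are present.
RowSepApplies : Tiling → ℕ → List ℕ → Set
RowSepApplies T r S =
  S ≢ [] ×
  (∀ i → i ∈ S → Nonempty T (i , r)) ×
  (∀ i j → i ∈ S → Nonempty T (j , r) → j ∉ S →
     (i < j → ob21 (i , r) (j , r) ∈ obs T) ×
     (j < i → ob12 (j , r) (i , r) ∈ obs T))

γ : ℕ → List ℕ → Cell → Cell
γ r S (i , j) with j <? r
... | yes _ = (i , j)
... | no _ with j ≟ r
...   | no _ = (i , suc j)
...   | yes _ with i ∈? S
...     | yes _ = (i , j)
...     | no _ = (i , suc j)

Γ : ℕ → List ℕ → GP → GP
Γ r S (gp n π c) = gp n π (map (γ r S) c)

{-# OPTIONS --safe #-}
module Submission where

-- γ_{r,S} is injective: it fixes rows below r, shifts rows above r up by one,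
-- and sends row r into rows r and r + 1, so moving every row k > r down to
-- k − 1 undoes it. Regridding along an injective cell map reflects
-- containment with the same embedding, hence Γ(h) ≼ Γ(g) gives h ≼ g.
-- The row-separation hypotheses are only needed for Γ to land in a tiling,
-- not for this reflection.

open import Defs
open import Data.Nat using (ℕ; suc; pred; _≤_; _<_; _≤?_; _<?_; _≟_; s≤s)
open import Data.Nat.Properties using (<⇒≤; ≮⇒≥; ≤-refl; n<1+n; <⇒≱)
open import Data.List using (List)
open import Data.List.Membership.DecPropositional _≟_ using (_∈?_)
open import Data.Vec using (Vec; map; lookup)
open import Data.Vec.Properties using (lookup-map)
open import Data.Product using (_,_)
open import Function.Definitions using (Injective)
open import Relation.Nullary using (yes; no)
open import Relation.Nullary.Negation using (contradiction)
open import Relation.Binary.PropositionalEquality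

map-cells-reflects-≼ : ∀ {f : Cell → Cell} → Injective _≡_ _≡_ f →
  ∀ {n m} (π : Vec ℕ n) (c : Vec Cell n) (σ : Vec ℕ m) (d : Vec Cell m) →
  gp n π (map f c) ≼ gp m σ (map f d) → gp n π c ≼ gp m σ d
map-cells-reflects-≼ {f} f-inj π c σ d (e , mono , iso , cells-eq) =
  e , mono , iso , λ a → f-inj (begin
    f (lookup c a)         ≡⟨ lookup-map a f c ⟨
    lookup (map f c) a     ≡⟨ cells-eq a ⟩
    lookup (map f d) (e a) ≡⟨ lookup-map (e a) f d ⟩
    f (lookup d (e a))     ∎)
  where open ≡-Reasoning

lowerAbove : ℕ → Cell → Cell
lowerAbove r (i , k) with k ≤? r
... | yes _ = (i , k)
... | no _ = (i , pred k)

lowerAbove-≤ : ∀ {r k} i → k ≤ r → lowerAbove r (i , k) ≡ (i , k)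
lowerAbove-≤ {r} {k} i k≤r with k ≤? r
... | yes _ = refl
... | no k≰r = contradiction k≤r k≰r

lowerAbove-> : ∀ {r k} i → r < k → lowerAbove r (i , k) ≡ (i , pred k)
lowerAbove-> {r} {k} i r<k with k ≤? r
... | yes k≤r = contradiction k≤r (<⇒≱ r<k)
... | no _ = refl

lowerAbove-γ : ∀ r S c → lowerAbove r (γ r S c) ≡ c
lowerAbove-γ r S (i , j) with j <? r
... | yes j<r = lowerAbove-≤ i (<⇒≤ j<r)
... | no j≮r with j ≟ r
...   | no _ = lowerAbove-> i (s≤s (≮⇒≥ j≮r))
...   | yes refl with i ∈? S
...     | yes _ = lowerAbove-≤ i ≤-refl
...     | no _ = lowerAbove-> i (n<1+n j)

γ-injective : ∀ r S → Injective _≡_ _≡_ (γ r S)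
γ-injective r S {c} {c′} γc≡γc′ = begin
  c                        ≡⟨ lowerAbove-γ r S c ⟨
  lowerAbove r (γ r S c)   ≡⟨ cong (lowerAbove r) γc≡γc′ ⟩
  lowerAbove r (γ r S c′)  ≡⟨ lowerAbove-γ r S c′ ⟩
  c′                       ∎
  where open ≡-Reasoning

lemma6p12 : (T : Tiling) (r : ℕ) (S : List ℕ) → RowSepApplies T r S →
    (h g : GP) → InGrid T h → InGrid T g →
    Γ r S h ≼ Γ r S g → h ≼ g
lemma6p12 T r S _ (gp n π c) (gp m σ d) _ _ =
  map-cells-reflects-≼ (γ-injective r S) π c σ d
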